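{- For all integers $k \geq 2$ and $r \geq 2k$, there exists a $k$-regular $0,1$ matrix $M$ satisfying \[\mathrm{rank}_{\mathrm{bin}}(M) = r\quad\text{and}\quad \mathrm{rank}_{\mathrm{bin}}(\overline{M}) \leq \Big \lceil \frac{k+1}{2k} \cdot r\Big \rceil + (2k-3).\]
   Context: A square $0,1$ matrix is $k$-regular if every row and every column has precisely $k$ ones. The complement $\overline{M}$ of a $0,1$ matrix $M$ is obtained by replacing ones by zeros and zeros by ones. The binary rank $\mathrm{rank}_{\mathrm{bin}}(A)$ of an $n\times n$ $0,1$ matrix $A$ is the smallest $r$ such that $A=A_1A_2$ (over the reals) with $A_1,A_2$ being $0,1$ matrices of dimensions $n\times r$ and $r\times n$; equivalently, the smallest number of combinatorial rectangles (all-one submatrices indexed by a set of rows times a set of columns) that partition the ones of $A$. -}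

module Defs where

open import Data.Nat using (ℕ; zero; suc; _+_; _*_; _∸_; _≤_; NonZero)
open import Data.Nat.DivMod using (_/_)
open import Data.Bool using (Bool; true; false; not)
open import Data.Fin using (Fin)
open import Data.Product using (Σ; _×_)
open import Relation.Binary.PropositionalEquality using (_≡_)

Matrix01 : ℕ → Set
Matrix01 n = Fin n → Fin n → Bool

b2n : Bool → ℕ
b2n true  = 1
b2n false = 0

∑ : (r : ℕ) → (Fin r → ℕ) → ℕ
∑ zero    f = 0
∑ (suc r) f = f Fin.zero + ∑ r (λ i → f (Fin.suc i))

rowCount : {n : ℕ} → Matrix01 n → Fin n → ℕ
rowCount {n} M i = ∑ n (λ j → b2n (M i j))

colCount : {n : ℕ} → Matrix01 n → Fin n → ℕ
colCount {n} M j = ∑ n (λ i → b2n (M i j))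

Regular : {n : ℕ} → ℕ → Matrix01 n → Set
Regular {n} k M = ((i : Fin n) → rowCount M i ≡ k) × ((j : Fin n) → colCount M j ≡ k)

complement : {n : ℕ} → Matrix01 n → Matrix01 n
complement M i j = not (M i j)

-- M = A1 A2 over the reals (equivalently over ℕ, since all entries are naturals),
-- with A1 an n×r and A2 an r×n 0,1 matrix
BinFactor : {n : ℕ} → Matrix01 n → ℕ → Set
BinFactor {n} M r =
  Σ (Fin n → Fin r → Bool) λ A1 →
  Σ (Fin r → Fin n → Bool) λ A2 →
  (i j : Fin n) → b2n (M i j) ≡ ∑ r (λ l → b2n (A1 i l) * b2n (A2 l j))

BinRankIs : {n : ℕ} → Matrix01 n → ℕ → Set
BinRankIs M r = BinFactor M r × ((r' : ℕ) → BinFactor M r' → r ≤ r')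

-- ceiling division ⌈a / b⌉, correct for b ≥ 1
-- (the divisor suc (b ∸ 1) equals b when b ≥ 1; written so no NonZero instance is needed)
⌈_/_⌉ : ℕ → ℕ → ℕ
⌈ a / b ⌉ = (a + b ∸ 1) / suc (b ∸ 1)

-- M is block diagonal: m copies of the 2k × 2k matrix D = (U L; L U), where U is the upper
-- triangular all-ones k × k matrix (diagonal included) and L = J − U, followed by t copies of the
-- all-ones k × k matrix J, where r = 2km + t with t < 2k. In every row and column of D the two
-- entries at the same offset of the two halves are complementary, so M is k-regular. Its r distinct
-- rows partition its ones into r rectangles, and the diagonals of the D-blocks together with one
-- entry of each J-block form a fooling set of size r (D h h′ = D h′ h = 1 forces h = h′).
--
-- The complement is partitioned into (k − 1) + m(k + 1) + t rectangles. Put column u of the left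
-- half of a D-block and column u of a J-block into class u, and all right-half columns of D-blocks
-- into class 0. For a block a and a position q of D, the rows (a, h) with D h q = 1, against the
-- columns of class offset(q) outside block a and the column of block a facing q (same offset, other
-- half), form a rectangle of zeros of M; as the two positions with a given offset are complementary,
-- these 2k rectangles partition the zeros in the rows of block a. For a right-half position of
-- offset v ≥ 1 the column set is the whole class v, independent of a, so these rectangles merge
-- across all m blocks. Each J-block adds its rows against all other columns. What remains is the
-- arithmetic (t ∸ (k − 2)) · 2k ≤ (k + 1) t + 2k − 1 for t < 2k.

module Submission where

open import Defs
open import Data.Nat using (ℕ; zero; suc; _+_; _*_; _∸_; _≤_; _<_; z≤n; s≤s; z<s; s≤s⁻¹)
open import Data.Nat.Properties
open import Data.Nat.DivMod using (_/_; _%_; m*n/n≡m; /-monoˡ-≤; m≡m%n+[m/n]*n; m%n<n)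
open import Data.Nat.Induction using (<-rec)
open import Data.Nat.Tactic.RingSolver using (solve-∀)
open import Data.Bool using (Bool; true; false; not; _∧_; if_then_else_)
open import Data.Bool.Properties using (not-involutive)
open import Data.Empty using (⊥-elim)
open import Relation.Binary.Definitions using (tri<; tri≈; tri>)
open import Data.Fin using (Fin; toℕ; fromℕ<; combine; remQuot; _↑ˡ_; _↑ʳ_) renaming (zero to fz; suc to fs; _<_ to _<ᶠ_)
open import Data.Fin.Properties as Fin using (any?; all?; toℕ<n; toℕ-fromℕ<; injective⇒≤; remQuot-combine; splitAt-↑ˡ; splitAt-↑ʳ; +↔⊎; *↔×)
open import Data.Fin.Subset using (Subset)
open import Data.Fin.Subset.Properties using (anySubset?)
open import Data.Vec using (lookup; tabulate)
open import Data.Vec.Properties using (lookup∘tabulate)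
open import Data.Product using (Σ; _×_; _,_; proj₁; proj₂; uncurry)
open import Data.Sum using (_⊎_; inj₁; inj₂)
open import Data.Sum.Function.Propositional using (_⊎-↔_)
open import Data.Product.Function.NonDependent.Propositional using (_×-↔_)
open import Function using (_∘_)
open import Function.Bundles using (Inverse; Injection; _↔_)
open import Function.Properties.Inverse using (↔⇒↣)
open import Function.Construct.Identity using (↔-id)
open import Function.Construct.Composition using (_↔-∘_)
open import Relation.Nullary using (Dec; yes; no; ¬_; does)
open import Relation.Nullary.Decidable using (map′; dec-true; dec-false)
open import Relation.Binary.PropositionalEquality
open import Algebra.Properties.CommutativeSemigroup +-commutativeSemigroup using (interchange)

∑-cong : ∀ n {f g : Fin n → ℕ} → (∀ i → f i ≡ g i) → ∑ n f ≡ ∑ n g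
∑-cong zero    f≗g = refl
∑-cong (suc n) f≗g = cong₂ _+_ (f≗g fz) (∑-cong n (f≗g ∘ fs))

∑-zero : ∀ n {f : Fin n → ℕ} → (∀ i → f i ≡ 0) → ∑ n f ≡ 0
∑-zero zero    f≗0 = refl
∑-zero (suc n) f≗0 = cong₂ _+_ (f≗0 fz) (∑-zero n (f≗0 ∘ fs))

∑-one : ∀ n → ∑ n (λ _ → 1) ≡ n
∑-one zero    = refl
∑-one (suc n) = cong suc (∑-one n)

∑-+ : ∀ n (f g : Fin n → ℕ) → ∑ n (λ i → f i + g i) ≡ ∑ n f + ∑ n g
∑-+ zero    f g = refl
∑-+ (suc n) f g = trans (cong (f fz + g fz +_) (∑-+ n (f ∘ fs) (g ∘ fs)))
                        (interchange (f fz) (g fz) (∑ n (f ∘ fs)) (∑ n (g ∘ fs)))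

∑-↑ : ∀ a b (f : Fin (a + b) → ℕ) → ∑ (a + b) f ≡ ∑ a (f ∘ (_↑ˡ b)) + ∑ b (f ∘ (a ↑ʳ_))
∑-↑ zero    b f = refl
∑-↑ (suc a) b f = trans (cong (f fz +_) (∑-↑ a b (f ∘ fs))) (sym (+-assoc (f fz) _ _))

∑-combine : ∀ a b (f : Fin (a * b) → ℕ) → ∑ (a * b) f ≡ ∑ a (λ i → ∑ b (λ j → f (combine i j)))
∑-combine zero    b f = refl
∑-combine (suc a) b f = trans (∑-↑ b (a * b) f) (cong (∑ b (f ∘ (_↑ˡ a * b)) +_) (∑-combine a b (f ∘ (b ↑ʳ_))))

∑-point : ∀ n (i : Fin n) (f : Fin n → ℕ) → (∀ j → j ≢ i → f j ≡ 0) → ∑ n f ≡ f i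
∑-point (suc n) fz     f vanish = trans (cong (f fz +_) (∑-zero n (λ j → vanish (fs j) λ ()))) (+-identityʳ (f fz))
∑-point (suc n) (fs i) f vanish = trans (cong (_+ ∑ n (f ∘ fs)) (vanish fz λ ()))
                                        (∑-point n i (f ∘ fs) (λ j j≢i → vanish (fs j) (j≢i ∘ Fin.suc-injective)))

∑-δˡ : ∀ n (i : Fin n) (F : Fin n → Bool → ℕ) → (∀ j → F j false ≡ 0) → ∑ n (λ j → F j (does (i Fin.≟ j))) ≡ F i true
∑-δˡ n i F F-false = trans (∑-point n i _ vanish) (cong (F i) (dec-true (i Fin.≟ i) refl))
  where
  vanish : ∀ j → j ≢ i → F j (does (i Fin.≟ j)) ≡ 0
  vanish j j≢i rewrite dec-false (i Fin.≟ j) (j≢i ∘ sym) = F-false j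

∑-δʳ : ∀ n (i : Fin n) (F : Fin n → Bool → ℕ) → (∀ j → F j false ≡ 0) → ∑ n (λ j → F j (does (j Fin.≟ i))) ≡ F i true
∑-δʳ n i F F-false = trans (∑-point n i _ vanish) (cong (F i) (dec-true (i Fin.≟ i) refl))
  where
  vanish : ∀ j → j ≢ i → F j (does (j Fin.≟ i)) ≡ 0
  vanish j j≢i rewrite dec-false (j Fin.≟ i) j≢i = F-false j

≤-∑ : ∀ n (f : Fin n → ℕ) (i : Fin n) → f i ≤ ∑ n f
≤-∑ (suc n) f fz     = m≤m+n (f fz) _
≤-∑ (suc n) f (fs i) = ≤-trans (≤-∑ n (f ∘ fs) i) (m≤n+m _ (f fz))

∑-positive : ∀ n (f : Fin n → ℕ) → 0 < ∑ n f → Σ (Fin n) λ i → 0 < f i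
∑-positive (suc n) f pos with f fz in eq
... | suc _ = fz , subst (0 <_) (sym eq) z<s
... | zero  = let (i , fi>0) = ∑-positive n (f ∘ fs) pos in fs i , fi>0

does⇒ : ∀ {P : Set} (P? : Dec P) → does P? ≡ true → P
does⇒ (yes p) _ = p

not-does⇒¬ : ∀ {P : Set} (P? : Dec P) → not (does P?) ≡ true → ¬ P
not-does⇒¬ (no ¬p) _ = ¬p

≮∧≯⇒≡ : ∀ {n} {i j : Fin n} → ¬ i <ᶠ j → ¬ j <ᶠ i → i ≡ j
≮∧≯⇒≡ {i = i} {j} i≮j j≮i with Fin.<-cmp i j
... | tri< i<j _ _ = ⊥-elim (i≮j i<j)
... | tri≈ _ i≡j _ = i≡j
... | tri> _ _ j<i = ⊥-elim (j≮i j<i)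

b2n-not : ∀ b → b2n b + b2n (not b) ≡ 1
b2n-not true  = refl
b2n-not false = refl

b2n-*-positive : ∀ x y → 0 < b2n x * b2n y → x ≡ true × y ≡ true
b2n-*-positive true true _ = refl , refl

∑-complementary : ∀ n (f g : Fin n → Bool) → (∀ i → g i ≡ not (f i)) → ∑ n (b2n ∘ f) + ∑ n (b2n ∘ g) ≡ n
∑-complementary n f g g≡¬f = begin
  ∑ n (b2n ∘ f) + ∑ n (b2n ∘ g)        ≡⟨ ∑-+ n (b2n ∘ f) (b2n ∘ g) ⟨
  ∑ n (λ i → b2n (f i) + b2n (g i))    ≡⟨ ∑-cong n (λ i → trans (cong (λ b → b2n (f i) + b2n b) (g≡¬f i)) (b2n-not (f i))) ⟩
  ∑ n (λ _ → 1)                        ≡⟨ ∑-one n ⟩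
  n                                    ∎
  where open ≡-Reasoning

b2n-positive : ∀ {b} → 0 < b2n b → b ≡ true
b2n-positive {true} _ = refl

fooling-set-bound : ∀ {n p} (M : Matrix01 n) (ρ γ : Fin p → Fin n) →
  (∀ l → M (ρ l) (γ l) ≡ true) →
  (∀ {l l′} → M (ρ l) (γ l′) ≡ true → M (ρ l′) (γ l) ≡ true → l ≡ l′) →
  ∀ {r} → BinFactor M r → p ≤ r
fooling-set-bound {n} {p} M ρ γ diagonal crossing {r} (A₁ , A₂ , M≡A₁A₂) = injective⇒≤ φ-injective
  where
  term : Fin n → Fin n → Fin r → ℕ
  term i j q = b2n (A₁ i q) * b2n (A₂ q j)

  covered⇒one : ∀ {i j} q → A₁ i q ≡ true → A₂ q j ≡ true → M i j ≡ true
  covered⇒one {i} {j} q A₁iq A₂qj = b2n-positive (subst (0 <_) (sym (M≡A₁A₂ i j))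
    (≤-trans (subst₂ (λ x y → 0 < b2n x * b2n y) (sym A₁iq) (sym A₂qj) z<s) (≤-∑ r (term i j) q)))

  rectangle : ∀ l → Σ (Fin r) λ q → A₁ (ρ l) q ≡ true × A₂ q (γ l) ≡ true
  rectangle l =
    let q , positive = ∑-positive r (term (ρ l) (γ l))
                         (subst (0 <_) (M≡A₁A₂ (ρ l) (γ l)) (subst (λ b → 0 < b2n b) (sym (diagonal l)) z<s))
    in q , b2n-*-positive _ _ positive

  φ : Fin p → Fin r
  φ = proj₁ ∘ rectangle

  rows-hit : ∀ l → A₁ (ρ l) (φ l) ≡ true
  rows-hit = proj₁ ∘ proj₂ ∘ rectangle

  cols-hit : ∀ l → A₂ (φ l) (γ l) ≡ true
  cols-hit = proj₂ ∘ proj₂ ∘ rectangle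

  φ-injective : ∀ {l l′} → φ l ≡ φ l′ → l ≡ l′
  φ-injective {l} {l′} φl≡φl′ = crossing
    (covered⇒one (φ l) (rows-hit l) (subst (λ q → A₂ q (γ l′) ≡ true) (sym φl≡φl′) (cols-hit l′)))
    (covered⇒one (φ l′) (rows-hit l′) (subst (λ q → A₂ q (γ l) ≡ true) φl≡φl′ (cols-hit l)))

unflatten : ∀ {a b} → Subset (a * b) → Fin a → Fin b → Bool
unflatten S i j = lookup S (combine i j)

flatten : ∀ {a b} → (Fin a → Fin b → Bool) → Subset (a * b)
flatten {b = b} A = tabulate (uncurry A ∘ remQuot b)

unflatten-flatten : ∀ {a b} (A : Fin a → Fin b → Bool) i j → unflatten (flatten A) i j ≡ A i j
unflatten-flatten {b = b} A i j = trans (lookup∘tabulate (uncurry A ∘ remQuot b) (combine i j)) (cong (uncurry A) (remQuot-combine i j))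

-- Exhaustive search, with both factors flattened to subsets so that anySubset? applies.
binFactor? : ∀ {n} (M : Matrix01 n) r → Dec (BinFactor M r)
binFactor? {n} M r = map′
  (λ (S , T , eq) → unflatten S , unflatten T , eq)
  (λ (A₁ , A₂ , eq) → flatten A₁ , flatten A₂ , λ i j → trans (eq i j) (∑-cong r λ l →
     sym (cong₂ (λ x y → b2n x * b2n y) (unflatten-flatten A₁ i l) (unflatten-flatten A₂ l j))))
  (anySubset? λ S → anySubset? λ T → all? λ i → all? λ j →
     b2n (M i j) ≟ ∑ r (λ l → b2n (unflatten S i l) * b2n (unflatten T l j)))

least-witness : ∀ {P : ℕ → Set} → (∀ n → Dec (P n)) → ∀ {p} → P p → Σ ℕ λ n → P n × (∀ m → P m → n ≤ m)
least-witness {P} P? {p} = <-rec Least step p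
  where
  Least : ℕ → Set
  Least p = P p → Σ ℕ λ n → P n × (∀ m → P m → n ≤ m)

  step : ∀ p → (∀ {q} → q < p → Least q) → Least p
  step p smaller Pp with any? (λ (i : Fin p) → P? (toℕ i))
  ... | yes (i , Pi) = smaller (toℕ<n i) Pi
  ... | no none = p , Pp , λ q Pq → ≮⇒≥ λ q<p → none (fromℕ< q<p , subst P (sym (toℕ-fromℕ< q<p)) Pq)

binRank-exists : ∀ {n} (M : Matrix01 n) {p} → BinFactor M p → Σ ℕ λ r → BinRankIs M r × r ≤ p
binRank-exists M {p} factor with least-witness (binFactor? M) factor
... | r , factor-r , minimal = r , (factor-r , minimal) , minimal p factor

record Finite (A : Set) : Set where
  field
    size  : ℕ
    index : Fin size ↔ A

  open Inverse index public using (to; from; strictlyInverseˡ; strictlyInverseʳ)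

  sum : (A → ℕ) → ℕ
  sum g = ∑ size (g ∘ to)

open Finite

finite-Fin : ∀ n → Finite (Fin n)
finite-Fin n = record { size = n ; index = ↔-id (Fin n) }

_⊎ᶠ_ : ∀ {A B} → Finite A → Finite B → Finite (A ⊎ B)
FA ⊎ᶠ FB = record { size = size FA + size FB ; index = (index FA ⊎-↔ index FB) ↔-∘ +↔⊎ }

_×ᶠ_ : ∀ {A B} → Finite A → Finite B → Finite (A × B)
FA ×ᶠ FB = record { size = size FA * size FB ; index = (index FA ×-↔ index FB) ↔-∘ *↔× }

sum-⊎ : ∀ {A B} (FA : Finite A) (FB : Finite B) (g : A ⊎ B → ℕ) →
  sum (FA ⊎ᶠ FB) g ≡ sum FA (g ∘ inj₁) + sum FB (g ∘ inj₂)
sum-⊎ FA FB g = trans (∑-↑ (size FA) (size FB) _) (cong₂ _+_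
  (∑-cong (size FA) λ i → cong (g ∘ Data.Sum.map (to FA) (to FB)) (splitAt-↑ˡ (size FA) i (size FB)))
  (∑-cong (size FB) λ i → cong (g ∘ Data.Sum.map (to FA) (to FB)) (splitAt-↑ʳ (size FA) (size FB) i)))

sum-× : ∀ {A B} (FA : Finite A) (FB : Finite B) (g : A × B → ℕ) →
  sum (FA ×ᶠ FB) g ≡ sum FA (λ a → sum FB (λ b → g (a , b)))
sum-× FA FB g = trans (∑-combine (size FA) (size FB) _) (∑-cong (size FA) λ i → ∑-cong (size FB) λ j →
  cong (g ∘ Data.Product.map (to FA) (to FB)) (remQuot-combine i j))

matrixOn : ∀ {A} (FA : Finite A) → (A → A → Bool) → Matrix01 (size FA)
matrixOn FA N i j = N (to FA i) (to FA j)

binFactor-matrixOn : ∀ {A B} (FA : Finite A) (FB : Finite B) (N : A → A → Bool) (U : A → B → Bool) (V : B → A → Bool) →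
  (∀ x y → b2n (N x y) ≡ sum FB (λ π → b2n (U x π) * b2n (V π y))) → BinFactor (matrixOn FA N) (size FB)
binFactor-matrixOn FA FB N U V N≡UV = (λ i l → U (to FA i) (to FB l)) , (λ l j → V (to FB l) (to FA j)) , λ i j → N≡UV (to FA i) (to FA j)

binFactor-rowRepresentatives : ∀ {A B} (FA : Finite A) (FB : Finite B) (N : A → A → Bool) (class : A → B) (rep : B → A) →
  (∀ x y → N x y ≡ N (rep (class x)) y) → BinFactor (matrixOn FA N) (size FB)
binFactor-rowRepresentatives FA FB N class rep N≡rep = binFactor-matrixOn FA FB N
  (λ x π → does (from FB (class x) Fin.≟ from FB π)) (λ π y → N (rep π) y) factorisation
  where
  factorisation : ∀ x y → b2n (N x y) ≡ sum FB (λ π → b2n (does (from FB (class x) Fin.≟ from FB π)) * b2n (N (rep π) y))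
  factorisation x y = begin
    b2n (N x y)                    ≡⟨ cong b2n (N≡rep x y) ⟩
    b2n (N (rep (class x)) y)      ≡⟨ cong (λ π → b2n (N (rep π) y)) (strictlyInverseˡ FB (class x)) ⟨
    b2n (N (rep (to FB l₀)) y)     ≡⟨ *-identityˡ _ ⟨
    1 * b2n (N (rep (to FB l₀)) y) ≡⟨ ∑-δˡ (size FB) l₀ (λ l b → b2n b * b2n (N (rep (to FB l)) y)) (λ _ → refl) ⟨
    ∑ (size FB) (λ l → b2n (does (l₀ Fin.≟ l)) * b2n (N (rep (to FB l)) y))
      ≡⟨ ∑-cong (size FB) (λ l → cong (λ l′ → b2n (does (l₀ Fin.≟ l′)) * b2n (N (rep (to FB l)) y)) (strictlyInverseʳ FB l)) ⟨
    sum FB (λ π → b2n (does (l₀ Fin.≟ from FB π)) * b2n (N (rep π) y)) ∎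
    where
    open ≡-Reasoning
    l₀ : Fin (size FB)
    l₀ = from FB (class x)

foolingSet-matrixOn : ∀ {A B} (FA : Finite A) (FB : Finite B) (N : A → A → Bool) (rep : B → A) →
  (∀ π → N (rep π) (rep π) ≡ true) →
  (∀ {π π′} → N (rep π) (rep π′) ≡ true → N (rep π′) (rep π) ≡ true → π ≡ π′) →
  ∀ {r} → BinFactor (matrixOn FA N) r → size FB ≤ r
foolingSet-matrixOn FA FB N rep diagonal crossing =
  fooling-set-bound (matrixOn FA N) ρ ρ (λ l → trans (entry l l) (diagonal (to FB l)))
    (λ {l} {l′} e e′ → Injection.injective (↔⇒↣ (index FB)) (crossing (trans (sym (entry l l′)) e) (trans (sym (entry l′ l)) e′)))
  where
  ρ : Fin (size FB) → Fin (size FA)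
  ρ = from FA ∘ rep ∘ to FB

  entry : ∀ l l′ → matrixOn FA N (ρ l) (ρ l′) ≡ N (rep (to FB l)) (rep (to FB l′))
  entry l l′ = cong₂ N (strictlyInverseˡ FA _) (strictlyInverseˡ FA _)


module BlockConstruction (k′ m t : ℕ) where

  k : ℕ
  k = suc k′

  Half : Set
  Half = Fin k ⊎ Fin k

  halves : Finite Half
  halves = finite-Fin k ⊎ᶠ finite-Fin k

  D : Half → Half → Bool
  D (inj₁ u) (inj₁ u′) = not (does (u′ Fin.<? u))
  D (inj₁ u) (inj₂ u′) = does (u′ Fin.<? u)
  D (inj₂ u) (inj₁ u′) = does (u′ Fin.<? u)
  D (inj₂ u) (inj₂ u′) = not (does (u′ Fin.<? u))

  D-flipʳ : ∀ h u → D h (inj₂ u) ≡ not (D h (inj₁ u))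
  D-flipʳ (inj₁ u) u′ = sym (not-involutive _)
  D-flipʳ (inj₂ u) u′ = refl

  D-flipˡ : ∀ u q → D (inj₂ u) q ≡ not (D (inj₁ u) q)
  D-flipˡ u (inj₁ u′) = sym (not-involutive _)
  D-flipˡ u (inj₂ u′) = refl

  D-rowSum : ∀ h → sum halves (b2n ∘ D h) ≡ k
  D-rowSum h = trans (sum-⊎ (finite-Fin k) (finite-Fin k) (b2n ∘ D h)) (∑-complementary k _ _ (D-flipʳ h))

  D-colSum : ∀ q → sum halves (λ h → b2n (D h q)) ≡ k
  D-colSum q = trans (sum-⊎ (finite-Fin k) (finite-Fin k) (λ h → b2n (D h q))) (∑-complementary k _ _ (λ u → D-flipˡ u q))

  D-diagonal : ∀ h → D h h ≡ true
  D-diagonal (inj₁ u) = cong not (dec-false (u Fin.<? u) (Fin.<-irrefl refl))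
  D-diagonal (inj₂ u) = cong not (dec-false (u Fin.<? u) (Fin.<-irrefl refl))

  D-antisym : ∀ {h h′} → D h h′ ≡ true → D h′ h ≡ true → h ≡ h′
  D-antisym {inj₁ u} {inj₁ u′} p q = cong inj₁ (≮∧≯⇒≡ (not-does⇒¬ (u Fin.<? u′) q) (not-does⇒¬ (u′ Fin.<? u) p))
  D-antisym {inj₁ u} {inj₂ u′} p q = ⊥-elim (Fin.<-asym (does⇒ (u′ Fin.<? u) p) (does⇒ (u Fin.<? u′) q))
  D-antisym {inj₂ u} {inj₁ u′} p q = ⊥-elim (Fin.<-asym (does⇒ (u′ Fin.<? u) p) (does⇒ (u Fin.<? u′) q))
  D-antisym {inj₂ u} {inj₂ u′} p q = cong inj₂ (≮∧≯⇒≡ (not-does⇒¬ (u Fin.<? u′) q) (not-does⇒¬ (u′ Fin.<? u) p))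

  Cell : Set
  Cell = (Fin m × Half) ⊎ (Fin t × Fin k)

  cells : Finite Cell
  cells = (finite-Fin m ×ᶠ halves) ⊎ᶠ (finite-Fin t ×ᶠ finite-Fin k)

  inOnesBlock : Fin t → Cell → Bool
  inOnesBlock c (inj₁ _)        = false
  inOnesBlock c (inj₂ (c′ , _)) = does (c Fin.≟ c′)

  entry : Cell → Cell → Bool
  entry (inj₁ (a , h)) (inj₁ (a′ , h′)) = does (a Fin.≟ a′) ∧ D h h′
  entry (inj₁ _)       (inj₂ _)         = false
  entry (inj₂ (c , _)) y                = inOnesBlock c y

  M : Matrix01 (size cells)
  M = matrixOn cells entry

  sum-cells : ∀ g → sum cells g ≡ ∑ m (λ a → sum halves (λ h → g (inj₁ (a , h)))) + ∑ t (λ c → ∑ k (λ x → g (inj₂ (c , x))))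
  sum-cells g = trans (sum-⊎ (finite-Fin m ×ᶠ halves) (finite-Fin t ×ᶠ finite-Fin k) g)
    (cong₂ _+_ (sum-× (finite-Fin m) halves (g ∘ inj₁)) (sum-× (finite-Fin t) (finite-Fin k) (g ∘ inj₂)))

  rowSum : ∀ x → sum cells (b2n ∘ entry x) ≡ k
  rowSum (inj₁ (a , h)) = begin
    sum cells (b2n ∘ entry (inj₁ (a , h)))
      ≡⟨ sum-cells (b2n ∘ entry (inj₁ (a , h))) ⟩
    ∑ m (λ a′ → sum halves (λ h′ → b2n (does (a Fin.≟ a′) ∧ D h h′))) + ∑ t (λ _ → ∑ k (λ _ → 0))
      ≡⟨ cong₂ _+_ (∑-δˡ m a (λ _ b → sum halves (λ h′ → b2n (b ∧ D h h′))) (λ _ → ∑-zero (k + k) (λ _ → refl)))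
                   (∑-zero t (λ _ → ∑-zero k (λ _ → refl))) ⟩
    sum halves (b2n ∘ D h) + 0
      ≡⟨ trans (+-identityʳ _) (D-rowSum h) ⟩
    k ∎
    where open ≡-Reasoning
  rowSum (inj₂ (c , _)) = begin
    sum cells (b2n ∘ inOnesBlock c)
      ≡⟨ sum-cells (b2n ∘ inOnesBlock c) ⟩
    ∑ m (λ _ → sum halves (λ _ → 0)) + ∑ t (λ c′ → ∑ k (λ _ → b2n (does (c Fin.≟ c′))))
      ≡⟨ cong₂ _+_ (∑-zero m (λ _ → ∑-zero (k + k) (λ _ → refl))) (∑-δˡ t c (λ _ b → ∑ k (λ _ → b2n b)) (λ _ → ∑-zero k (λ _ → refl))) ⟩
    ∑ k (λ _ → 1)
      ≡⟨ ∑-one k ⟩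
    k ∎
    where open ≡-Reasoning

  colSum : ∀ y → sum cells (λ x → b2n (entry x y)) ≡ k
  colSum (inj₁ (a′ , h′)) = begin
    sum cells (λ x → b2n (entry x (inj₁ (a′ , h′))))
      ≡⟨ sum-cells (λ x → b2n (entry x (inj₁ (a′ , h′)))) ⟩
    ∑ m (λ a → sum halves (λ h → b2n (does (a Fin.≟ a′) ∧ D h h′))) + ∑ t (λ _ → ∑ k (λ _ → 0))
      ≡⟨ cong₂ _+_ (∑-δʳ m a′ (λ _ b → sum halves (λ h → b2n (b ∧ D h h′))) (λ _ → ∑-zero (k + k) (λ _ → refl)))
                   (∑-zero t (λ _ → ∑-zero k (λ _ → refl))) ⟩
    sum halves (λ h → b2n (D h h′)) + 0
      ≡⟨ trans (+-identityʳ _) (D-colSum h′) ⟩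
    k ∎
    where open ≡-Reasoning
  colSum (inj₂ (c′ , x′)) = begin
    sum cells (λ x → b2n (entry x (inj₂ (c′ , x′))))
      ≡⟨ sum-cells (λ x → b2n (entry x (inj₂ (c′ , x′)))) ⟩
    ∑ m (λ _ → sum halves (λ _ → 0)) + ∑ t (λ c → ∑ k (λ _ → b2n (does (c Fin.≟ c′))))
      ≡⟨ cong₂ _+_ (∑-zero m (λ _ → ∑-zero (k + k) (λ _ → refl))) (∑-δʳ t c′ (λ _ b → ∑ k (λ _ → b2n b)) (λ _ → ∑-zero k (λ _ → refl))) ⟩
    ∑ k (λ _ → 1)
      ≡⟨ ∑-one k ⟩
    k ∎
    where open ≡-Reasoning

  M-regular : Regular k M
  M-regular = (λ i → rowSum (to cells i)) , (λ j → colSum (to cells j))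

  RowClass : Set
  RowClass = (Fin m × Half) ⊎ Fin t

  rowClasses : Finite RowClass
  rowClasses = (finite-Fin m ×ᶠ halves) ⊎ᶠ finite-Fin t

  rowClass : Cell → RowClass
  rowClass (inj₁ d)       = inj₁ d
  rowClass (inj₂ (c , _)) = inj₂ c

  representative : RowClass → Cell
  representative (inj₁ d) = inj₁ d
  representative (inj₂ c) = inj₂ (c , fz)

  representative-diagonal : ∀ π → entry (representative π) (representative π) ≡ true
  representative-diagonal (inj₁ (a , h)) = cong₂ _∧_ (dec-true (a Fin.≟ a) refl) (D-diagonal h)
  representative-diagonal (inj₂ c)       = dec-true (c Fin.≟ c) refl

  representative-crossing : ∀ {π π′} → entry (representative π) (representative π′) ≡ true →
    entry (representative π′) (representative π) ≡ true → π ≡ π′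
  representative-crossing {inj₁ (a , h)} {inj₁ (a′ , h′)} p q with a Fin.≟ a′ | a′ Fin.≟ a
  ... | yes refl | yes _ = cong (λ h → inj₁ (a , h)) (D-antisym p q)
  representative-crossing {inj₂ c} {inj₂ c′} p q = cong inj₂ (does⇒ (c Fin.≟ c′) p)

  M-binRank : BinRankIs M (size rowClasses)
  M-binRank = binFactor-rowRepresentatives cells rowClasses entry rowClass representative (λ { (inj₁ _) _ → refl ; (inj₂ _) _ → refl })
            , λ r → foolingSet-matrixOn cells rowClasses entry representative representative-diagonal representative-crossing

  -- inj₁ v: the rectangle shared by all D-blocks at right-half position fs v;
  -- inj₂ (inj₁ (a , i)): the rectangle of block a at position (position i);
  -- inj₂ (inj₂ c): the rows of the c-th J-block against all other columns.
  Rect : Set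
  Rect = Fin k′ ⊎ ((Fin m × Fin (suc k)) ⊎ Fin t)

  rectangles : Finite Rect
  rectangles = finite-Fin k′ ⊎ᶠ ((finite-Fin m ×ᶠ finite-Fin (suc k)) ⊎ᶠ finite-Fin t)

  sum-rectangles : ∀ g → sum rectangles g ≡
    ∑ k′ (g ∘ inj₁) + (∑ m (λ a → ∑ (suc k) (λ i → g (inj₂ (inj₁ (a , i))))) + ∑ t (g ∘ inj₂ ∘ inj₂))
  sum-rectangles g = trans (sum-⊎ (finite-Fin k′) ((finite-Fin m ×ᶠ finite-Fin (suc k)) ⊎ᶠ finite-Fin t) g) (cong (∑ k′ (g ∘ inj₁) +_)
    (trans (sum-⊎ (finite-Fin m ×ᶠ finite-Fin (suc k)) (finite-Fin t) (g ∘ inj₂))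
           (cong (_+ ∑ t (g ∘ inj₂ ∘ inj₂)) (sum-× (finite-Fin m) (finite-Fin (suc k)) (g ∘ inj₂ ∘ inj₁)))))

  position : Fin (suc k) → Half
  position fz     = inj₂ fz
  position (fs v) = inj₁ v

  offset : Half → Fin k
  offset (inj₁ u) = u
  offset (inj₂ u) = u

  class : Half → Fin k
  class (inj₁ u) = u
  class (inj₂ _) = fz

  cellClass : Cell → Fin k
  cellClass (inj₁ (_ , q)) = class q
  cellClass (inj₂ (_ , x)) = x

  facing : Half → Half → Bool
  facing (inj₁ v) (inj₂ u) = does (v Fin.≟ u)
  facing (inj₂ v) (inj₁ u) = does (v Fin.≟ u)
  facing _        _        = false

  columns : Fin m → Half → Cell → Bool
  columns a q (inj₁ (a′ , q′)) = if does (a Fin.≟ a′) then facing q q′ else does (offset q Fin.≟ class q′)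
  columns a q (inj₂ (_ , x))   = does (offset q Fin.≟ x)

  rowsOf : Cell → Rect → Bool
  rowsOf (inj₁ (a , h)) (inj₁ v)                  = D h (inj₂ (fs v))
  rowsOf (inj₁ (a , h)) (inj₂ (inj₁ (a′ , i)))     = does (a Fin.≟ a′) ∧ D h (position i)
  rowsOf (inj₂ (c , _)) (inj₂ (inj₂ c′))          = does (c Fin.≟ c′)
  rowsOf _              _                        = false

  colsOf : Rect → Cell → Bool
  colsOf (inj₁ v)               y = does (fs v Fin.≟ cellClass y)
  colsOf (inj₂ (inj₁ (a , i)))  y = columns a (position i) y
  colsOf (inj₂ (inj₂ c))        y = not (inOnesBlock c y)

  shared-columns : ∀ a v y → colsOf (inj₁ v) y ≡ columns a (inj₂ (fs v)) y
  shared-columns a v (inj₂ _) = refl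
  shared-columns a v (inj₁ (a′ , q′)) with does (a Fin.≟ a′) | q′
  ... | false | _      = refl
  ... | true  | inj₁ _ = refl
  ... | true  | inj₂ _ = refl

  one-per-class : ∀ h w → ∑ k (λ u → b2n (D h (inj₁ u)) * b2n (does (u Fin.≟ w)))
                        + ∑ k (λ u → b2n (D h (inj₂ u)) * b2n (does (u Fin.≟ w))) ≡ 1
  one-per-class h w = begin
    ∑ k (λ u → b2n (D h (inj₁ u)) * b2n (does (u Fin.≟ w))) + ∑ k (λ u → b2n (D h (inj₂ u)) * b2n (does (u Fin.≟ w)))
      ≡⟨ cong₂ _+_ (∑-δʳ k w (λ u b → b2n (D h (inj₁ u)) * b2n b) (λ u → *-zeroʳ (b2n (D h (inj₁ u)))))
                   (∑-δʳ k w (λ u b → b2n (D h (inj₂ u)) * b2n b) (λ u → *-zeroʳ (b2n (D h (inj₂ u))))) ⟩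
    b2n (D h (inj₁ w)) * 1 + b2n (D h (inj₂ w)) * 1
      ≡⟨ cong₂ _+_ (*-identityʳ _) (trans (*-identityʳ _) (cong b2n (D-flipʳ h w))) ⟩
    b2n (D h (inj₁ w)) + b2n (not (D h (inj₁ w)))
      ≡⟨ b2n-not (D h (inj₁ w)) ⟩
    1 ∎
    where open ≡-Reasoning

  cover-own-block : ∀ h q′ → ∑ k (λ u → b2n (D h (inj₁ u)) * b2n (facing (inj₁ u) q′))
                      + ∑ k (λ u → b2n (D h (inj₂ u)) * b2n (facing (inj₂ u) q′)) ≡ b2n (not (D h q′))
  cover-own-block h (inj₁ u′) = begin
    ∑ k (λ u → b2n (D h (inj₁ u)) * 0) + ∑ k (λ u → b2n (D h (inj₂ u)) * b2n (does (u Fin.≟ u′)))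
      ≡⟨ cong₂ _+_ (∑-zero k (λ u → *-zeroʳ (b2n (D h (inj₁ u)))))
                   (∑-δʳ k u′ (λ u b → b2n (D h (inj₂ u)) * b2n b) (λ u → *-zeroʳ (b2n (D h (inj₂ u))))) ⟩
    b2n (D h (inj₂ u′)) * 1
      ≡⟨ trans (*-identityʳ _) (cong b2n (D-flipʳ h u′)) ⟩
    b2n (not (D h (inj₁ u′))) ∎
    where open ≡-Reasoning
  cover-own-block h (inj₂ u′) = begin
    ∑ k (λ u → b2n (D h (inj₁ u)) * b2n (does (u Fin.≟ u′))) + ∑ k (λ u → b2n (D h (inj₂ u)) * 0)
      ≡⟨ cong₂ _+_ (∑-δʳ k u′ (λ u b → b2n (D h (inj₁ u)) * b2n b) (λ u → *-zeroʳ (b2n (D h (inj₁ u)))))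
                   (∑-zero k (λ u → *-zeroʳ (b2n (D h (inj₂ u))))) ⟩
    b2n (D h (inj₁ u′)) * 1 + 0
      ≡⟨ trans (+-identityʳ _) (*-identityʳ _) ⟩
    b2n (D h (inj₁ u′))
      ≡⟨ cong b2n (trans (cong not (D-flipʳ h u′)) (not-involutive _)) ⟨
    b2n (not (D h (inj₂ u′))) ∎
    where open ≡-Reasoning

  contribution : Fin m → Half → Cell → Half → ℕ
  contribution a h y q = b2n (D h q) * b2n (columns a q y)

  cover-by-positions : ∀ a h y → ∑ k (contribution a h y ∘ inj₁) + ∑ k (contribution a h y ∘ inj₂) ≡ b2n (not (entry (inj₁ (a , h)) y))
  cover-by-positions a h (inj₂ (_ , x))   = one-per-class h x
  cover-by-positions a h (inj₁ (a′ , q′)) with a Fin.≟ a′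
  ... | no _     = one-per-class h (class q′)
  ... | yes refl = cover-own-block h q′

  complement-cover : ∀ x y → b2n (not (entry x y)) ≡ sum rectangles (λ π → b2n (rowsOf x π) * b2n (colsOf π y))
  complement-cover (inj₁ (a , h)) y = sym (begin
    sum rectangles (λ π → b2n (rowsOf (inj₁ (a , h)) π) * b2n (colsOf π y))
      ≡⟨ sum-rectangles (λ π → b2n (rowsOf (inj₁ (a , h)) π) * b2n (colsOf π y)) ⟩
    ∑ k′ (λ v → b2n (D h (inj₂ (fs v))) * b2n (colsOf (inj₁ v) y))
      + (∑ m (λ a′ → ∑ (suc k) (λ i → b2n (does (a Fin.≟ a′) ∧ D h (position i)) * b2n (columns a′ (position i) y))) + ∑ t (λ _ → 0))
      ≡⟨ cong₂ _+_ (∑-cong k′ (λ v → cong (λ b → b2n (D h (inj₂ (fs v))) * b2n b) (shared-columns a v y)))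
                   (cong₂ _+_ (∑-δˡ m a (λ a′ b → ∑ (suc k) (λ i → b2n (b ∧ D h (position i)) * b2n (columns a′ (position i) y)))
                                        (λ _ → ∑-zero (suc k) (λ _ → refl)))
                              (∑-zero t (λ _ → refl))) ⟩
    ∑ k′ (g ∘ inj₂ ∘ fs) + ((g (inj₂ fz) + ∑ k (g ∘ inj₁)) + 0)
      ≡⟨ regroup (∑ k′ (g ∘ inj₂ ∘ fs)) (g (inj₂ fz)) (∑ k (g ∘ inj₁)) ⟩
    ∑ k (g ∘ inj₁) + ∑ (suc k′) (g ∘ inj₂)
      ≡⟨ cover-by-positions a h y ⟩
    b2n (not (entry (inj₁ (a , h)) y)) ∎)
    where
    open ≡-Reasoning
    g : Half → ℕ
    g = contribution a h y
    regroup : ∀ x y z → x + ((y + z) + 0) ≡ z + (y + x)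
    regroup = solve-∀
  complement-cover (inj₂ (c , _)) y = sym (begin
    sum rectangles (λ π → b2n (rowsOf (inj₂ (c , _)) π) * b2n (colsOf π y))
      ≡⟨ sum-rectangles (λ π → b2n (rowsOf (inj₂ (c , _)) π) * b2n (colsOf π y)) ⟩
    ∑ k′ (λ _ → 0) + (∑ m (λ _ → ∑ (suc k) (λ _ → 0)) + ∑ t (λ c′ → b2n (does (c Fin.≟ c′)) * b2n (not (inOnesBlock c′ y))))
      ≡⟨ cong₂ _+_ (∑-zero k′ (λ _ → refl)) (cong₂ _+_ (∑-zero m (λ _ → ∑-zero (suc k) (λ _ → refl)))
                                                      (∑-δˡ t c (λ c′ b → b2n b * b2n (not (inOnesBlock c′ y))) (λ _ → refl))) ⟩
    1 * b2n (not (inOnesBlock c y))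
      ≡⟨ *-identityˡ _ ⟩
    b2n (not (inOnesBlock c y)) ∎)
    where open ≡-Reasoning

  complement-binFactor : BinFactor (complement M) (size rectangles)
  complement-binFactor = binFactor-matrixOn cells rectangles (λ x y → not (entry x y)) rowsOf colsOf complement-cover

≤⌈/⌉ : ∀ {x a} b → x * suc b ≤ a + b → x ≤ ⌈ a / suc b ⌉
≤⌈/⌉ {x} {a} b x*b≤a+b = begin
  x                     ≡⟨ m*n/n≡m x (suc b) ⟨
  x * suc b / suc b     ≤⟨ /-monoˡ-≤ (suc b) x*b≤a+b ⟩
  (a + b) / suc b       ≡⟨ cong (λ n → (n ∸ 1) / suc b) (+-suc a b) ⟨
  ⌈ a / suc b ⌉         ∎
  where open ≤-Reasoning

excess-bound : ∀ j t → t < (2 + j) + (2 + j) → (t ∸ j) * suc (3 + 2 * j) ≤ (3 + j) * t + (3 + 2 * j)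
excess-bound j t t<2k with ≤-total t j
... | inj₁ t≤j rewrite m≤n⇒m∸n≡0 t≤j = z≤n
... | inj₂ j≤t with ≤⇒≤″ j≤t
... | record { quotient = s ; equality = refl } = begin
  (j + s ∸ j) * suc (3 + 2 * j)                ≡⟨ cong (_* suc (3 + 2 * j)) (m+n∸m≡n j s) ⟩
  s * suc (3 + 2 * j)                          ≡⟨ split s j ⟩
  s * (3 + j) + s * (1 + j)                    ≤⟨ +-monoʳ-≤ (s * (3 + j)) (*-monoˡ-≤ (1 + j) s≤3+j) ⟩
  s * (3 + j) + (3 + j) * (1 + j)              ≤⟨ +-monoʳ-≤ (s * (3 + j)) (m≤m+n _ j) ⟩
  s * (3 + j) + ((3 + j) * (1 + j) + j)        ≡⟨ merge s j ⟩
  (3 + j) * (j + s) + (3 + 2 * j)              ∎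
  where
  open ≤-Reasoning
  s≤3+j : s ≤ 3 + j
  s≤3+j = s≤s⁻¹ (+-cancelˡ-< j s (4 + j) (subst (j + s <_) (double j) t<2k))
    where
    double : ∀ j → (2 + j) + (2 + j) ≡ j + (4 + j)
    double = solve-∀
  split : ∀ s j → s * suc (3 + 2 * j) ≡ s * (3 + j) + s * (1 + j)
  split = solve-∀
  merge : ∀ s j → s * (3 + j) + ((3 + j) * (1 + j) + j) ≡ (3 + j) * (j + s) + (3 + 2 * j)
  merge = solve-∀

complement-bound : ∀ j m t → t < (2 + j) + (2 + j) →
  (1 + j) + (m * (3 + j) + t) ≤ ⌈ ((2 + j + 1) * (m * ((2 + j) + (2 + j)) + t)) / (2 * (2 + j)) ⌉ + (2 * (2 + j) ∸ 3)
complement-bound j m t t<2k = begin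
  (1 + j) + (m * (3 + j) + t)                    ≤⟨ +-monoʳ-≤ (1 + j) (+-monoʳ-≤ (m * (3 + j)) (m≤n+m∸n t j)) ⟩
  (1 + j) + (m * (3 + j) + (j + s))              ≡⟨ regroup j m s ⟩
  X + (1 + 2 * j)                                ≡⟨ cong (λ n → X + (n ∸ 3)) (four+2j j) ⟨
  X + (2 * (2 + j) ∸ 3)                          ≤⟨ +-monoˡ-≤ (2 * (2 + j) ∸ 3) X≤⌈⌉ ⟩
  ⌈ A / (2 * (2 + j)) ⌉ + (2 * (2 + j) ∸ 3)      ∎
  where
  open ≤-Reasoning
  s X A : ℕ
  s = t ∸ j
  X = m * (3 + j) + s
  A = (2 + j + 1) * (m * ((2 + j) + (2 + j)) + t)
  four+2j : ∀ j → 2 * (2 + j) ≡ 3 + (1 + 2 * j)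
  four+2j = solve-∀
  regroup : ∀ j m s → (1 + j) + (m * (3 + j) + (j + s)) ≡ (m * (3 + j) + s) + (1 + 2 * j)
  regroup = solve-∀
  expand : ∀ j m s → (m * (3 + j) + s) * suc (3 + 2 * j) ≡ m * (3 + j) * suc (3 + 2 * j) + s * suc (3 + 2 * j)
  expand = solve-∀
  collect : ∀ j m t → m * (3 + j) * suc (3 + 2 * j) + ((3 + j) * t + (3 + 2 * j))
                      ≡ (2 + j + 1) * (m * ((2 + j) + (2 + j)) + t) + (3 + 2 * j)
  collect = solve-∀
  X≤⌈⌉ : X ≤ ⌈ A / (2 * (2 + j)) ⌉
  X≤⌈⌉ = subst (λ d → X ≤ ⌈ A / d ⌉) (sym (four+2j j)) (≤⌈/⌉ (3 + 2 * j) (begin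
    X * suc (3 + 2 * j)                                     ≡⟨ expand j m s ⟩
    m * (3 + j) * suc (3 + 2 * j) + s * suc (3 + 2 * j)     ≤⟨ +-monoʳ-≤ _ (excess-bound j t t<2k) ⟩
    m * (3 + j) * suc (3 + 2 * j) + ((3 + j) * t + (3 + 2 * j)) ≡⟨ collect j m t ⟩
    A + (3 + 2 * j)                                         ∎))

theorem1p3 : (k r : ℕ) → 2 ≤ k → 2 * k ≤ r →
    Σ ℕ λ n → Σ (Matrix01 n) λ M →
      Regular k M × BinRankIs M r ×
      Σ ℕ λ r̄ → BinRankIs (complement M) r̄ ×
        r̄ ≤ ⌈ ((k + 1) * r) / (2 * k) ⌉ + (2 * k ∸ 3)
theorem1p3 (suc (suc j)) r (s≤s (s≤s z≤n)) _ =
  let r̄ , r̄-binRank , r̄≤size = binRank-exists (complement M) complement-binFactor in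
  size cells , M , M-regular , subst (BinRankIs M) r≡ M-binRank , r̄ , r̄-binRank ,
    ≤-trans r̄≤size (subst (λ r → size rectangles ≤ ⌈ ((k + 1) * r) / (2 * k) ⌉ + (2 * k ∸ 3)) r≡
                          (complement-bound j m t (m%n<n r d)))
  where
  d m t : ℕ
  d = suc (suc j) + suc (suc j)
  m = r / d
  t = r % d
  open BlockConstruction (suc j) m t
  r≡ : m * d + t ≡ r
  r≡ = trans (+-comm (m * d) t) (sym (m≡m%n+[m/n]*n r d))
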